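{- Let $R$ be a $\mathbb{Q}$-algebra and $u\in R\langle\langle e_0,e_1\rangle\rangle\hat\otimes R\langle\langle e_0,e_1\rangle\rangle$. Then $u$ commutes with $e_1\otimes1+1\otimes e_1$ if and only if $u\in R\langle\langle e_1\rangle\rangle\hat\otimes R\langle\langle e_1\rangle\rangle$, i.e. $u[w\otimes w']=0$ whenever $w$ or $w'$ is not a power of $e_1$.
   Context: $R\langle\langle e_0,e_1\rangle\rangle\hat\otimes R\langle\langle e_0,e_1\rangle\rangle$ denotes formal series $u=\sum_{w,w'}u[w\otimes w']\,w\otimes w'$ over pairs of words in $e_0,e_1$, with product $(w_1\otimes w_1')(w_2\otimes w_2')=w_1w_2\otimes w_1'w_2'$ extended bilinearly and continuously. $R\langle\langle e_1\rangle\rangle$ is the subalgebra of series in $e_1$ alone. -}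

module Defs where

open import Level using (Level)
open import Algebra.Bundles using (CommutativeRing)
open import Data.Nat using (ℕ; zero; suc)
open import Data.List using (List; []; _∷_; replicate)
open import Data.Product using (_×_; _,_; ∃)
open import Relation.Binary.PropositionalEquality using (_≡_)

data Letter : Set where
  e₀ e₁ : Letter

Word : Set
Word = List Letter

splits : Word → List (Word × Word)
splits []      = ([] , []) ∷ []
splits (x ∷ w) = ([] , x ∷ w) ∷ Data.List.map (λ { (a , b) → (x ∷ a , b) }) (splits w)
  where import Data.List

IsE1Power : Word → Set
IsE1Power w = ∃ λ n → w ≡ replicate n e₁

module Series {c ℓ : Level} (R : CommutativeRing c ℓ) where
  open CommutativeRing R

  fromℕ : ℕ → Carrier
  fromℕ zero    = 0#
  fromℕ (suc n) = 1# + fromℕ n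

  -- R is a ℚ-algebra: every positive integer is invertible in R
  -- (equivalently, the unique ring map ℤ → R extends to ℚ → R).
  IsℚAlgebra : Set (c Level.⊔ ℓ)
  IsℚAlgebra = ∀ n → ∃ λ y → fromℕ (suc n) * y ≈ 1#

  sumR : List Carrier → Carrier
  sumR []       = 0#
  sumR (x ∷ xs) = x + sumR xs

  -- Elements of R⟨⟨e₀,e₁⟩⟩ ⊗̂ R⟨⟨e₀,e₁⟩⟩: u[w ⊗ w'] = u w w'.
  Ser² : Set c
  Ser² = Word → Word → Carrier

  -- Product: (u v)[w ⊗ w'] = Σ_{w = a b, w' = a' b'} u[a ⊗ a'] v[b ⊗ b'].
  _⋆_ : Ser² → Ser² → Ser²
  (u ⋆ v) w w' =
    sumR (Data.List.map (λ { (a , b) →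
      sumR (Data.List.map (λ { (a' , b') → u a a' * v b b' }) (splits w')) })
      (splits w))
    where import Data.List

  _≈ˢ_ : Ser² → Ser² → Set ℓ
  u ≈ˢ v = ∀ w w' → u w w' ≈ v w w'

  δ : Word → Word → Carrier
  δ [] [] = 1#
  δ [] (_ ∷ _) = 0#
  δ (_ ∷ _) [] = 0#
  δ (e₀ ∷ xs) (e₀ ∷ ys) = δ xs ys
  δ (e₁ ∷ xs) (e₁ ∷ ys) = δ xs ys
  δ (e₀ ∷ _) (e₁ ∷ _) = 0#
  δ (e₁ ∷ _) (e₀ ∷ _) = 0#

  mono : Word → Word → Ser²
  mono w₀ w₀' w w' = δ w₀ w * δ w₀' w'

  _+ˢ_ : Ser² → Ser² → Ser²
  (u +ˢ v) w w' = u w w' + v w w'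

  Δe₁ : Ser²
  Δe₁ = mono (e₁ ∷ []) [] +ˢ mono [] (e₁ ∷ [])

-- For a one-variable series f write f·e₁ and e₁·f for its products with the
-- letter e₁:  (f·e₁)[w] = f[a] if w = a e₁ and 0 otherwise, and dually
-- (e₁·f)[w] = f[a] if w = e₁ a.  Since Δe₁ = e₁ ⊗ 1 + 1 ⊗ e₁ and ⋆ is bilinear,
-- the coefficient of w ⊗ w' in u ⋆ Δe₁ is (u[-,w']·e₁)[w] + (u[w,-]·e₁)[w'],
-- and in Δe₁ ⋆ u it is (e₁·u[-,w'])[w] + (e₁·u[w,-])[w'].
--
-- (⇐) If u is supported on powers of e₁, both sides of CommEq vanish as soon
--     as w or w' is not a power of e₁; on powers of e₁, f·e₁ and e₁·f agree.
-- (⇒) Every word that is not a power of e₁ has the form e₁ᵏ e₀ t.  The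
--     equation CommEq u (e₁ᵏ e₀ t e₁) w' expresses u[e₁ᵏ e₀ t ⊗ w'] through
--     coefficients whose measure k + |w'| is smaller, so it vanishes by
--     induction; the case of the second factor follows by transposition.
module Submission where

open import Defs
open import Level using (Level)
open import Algebra.Bundles using (CommutativeRing)
open import Data.Sum using (_⊎_; inj₁; inj₂)
open import Relation.Nullary using (¬_)
open import Function.Bundles using (_⇔_; mk⇔)
open import Data.Nat using (ℕ; zero; suc; _<_; _≤_; s≤s) renaming (_+_ to _+ℕ_)
open import Data.Nat.Properties using (+-monoʳ-<; <-≤-trans; n<1+n)
open import Data.List using ([]; _∷_; replicate; map; length; _++_; _∷ʳ_)
open import Data.List.Properties using (map-∘; ++-assoc)
open import Data.Product using (_×_; _,_)
open import Data.Empty using (⊥-elim)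
open import Relation.Binary.PropositionalEquality as P using (_≡_)

mixed : ℕ → Word → Word
mixed k t = replicate k e₁ ++ e₀ ∷ t

data E1View : Word → Set where
  is-power : ∀ n → E1View (replicate n e₁)
  is-mixed : ∀ k t → E1View (mixed k t)

e1View : ∀ w → E1View w
e1View []       = is-power 0
e1View (e₀ ∷ t) = is-mixed 0 t
e1View (e₁ ∷ w) with e1View w
... | is-power n   = is-power (suc n)
... | is-mixed k t = is-mixed (suc k) t

mixed-not-power : ∀ k t → ¬ IsE1Power (mixed k t)
mixed-not-power zero    t (zero  , ())
mixed-not-power zero    t (suc n , ())
mixed-not-power (suc k) t (zero  , ())
mixed-not-power (suc k) t (suc n , eq) = mixed-not-power k t (n , P.cong tail eq)
  where
    tail : Word → Word
    tail []      = []
    tail (_ ∷ w) = w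

mixed-∷ʳ : ∀ k t → mixed k t ∷ʳ e₁ ≡ mixed k (t ∷ʳ e₁)
mixed-∷ʳ k t = ++-assoc (replicate k e₁) (e₀ ∷ t) (e₁ ∷ [])

power-e₁∷ : ∀ {a} → IsE1Power a → IsE1Power (e₁ ∷ a)
power-e₁∷ (n , eq) = suc n , P.cong (e₁ ∷_) eq

power-∷ʳe₁ : ∀ {a} → IsE1Power a → IsE1Power (a ∷ʳ e₁)
power-∷ʳe₁ (n , P.refl) = suc n , replicate-∷ʳ n
  where
    replicate-∷ʳ : ∀ n → replicate n e₁ ∷ʳ e₁ ≡ replicate (suc n) e₁
    replicate-∷ʳ zero    = P.refl
    replicate-∷ʳ (suc n) = P.cong (e₁ ∷_) (replicate-∷ʳ n)

tail-shorter : ∀ {a w : Word} x → x ∷ a ≡ w → length a < length w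
tail-shorter x P.refl = n<1+n _

init-shorter : ∀ {a w : Word} x → a ∷ʳ x ≡ w → length a < length w
init-shorter {a} x P.refl = P.subst (length a <_) (P.sym (length-∷ʳ a)) (n<1+n _)
  where
    length-∷ʳ : ∀ (b : Word) → length (b ∷ʳ x) ≡ suc (length b)
    length-∷ʳ []      = P.refl
    length-∷ʳ (_ ∷ b) = P.cong suc (length-∷ʳ b)

module Commutation {c ℓ : Level} (R : CommutativeRing c ℓ) where
  open CommutativeRing R
  open Series R
  open import Relation.Binary.Reasoning.Setoid setoid
  open import Algebra.Properties.CommutativeSemigroup +-commutativeSemigroup
    using () renaming (interchange to +-interchange)

  Σsplit : Word → (Word → Word → Carrier) → Carrier
  Σsplit []      F = F [] [] + 0#
  Σsplit (x ∷ w) F = F [] (x ∷ w) + Σsplit w (λ a b → F (x ∷ a) b)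

  Σsplit-≡ : ∀ w (f : Word × Word → Carrier) →
    sumR (map f (splits w)) ≡ Σsplit w (λ a b → f (a , b))
  Σsplit-≡ []      f = P.refl
  Σsplit-≡ (x ∷ w) f = P.cong (f ([] , x ∷ w) +_)
    (P.trans (P.cong sumR (P.sym (map-∘ (splits w)))) (Σsplit-≡ w _))

  Σsplit-cong : ∀ w {F G : Word → Word → Carrier} → (∀ a b → F a b ≈ G a b) → Σsplit w F ≈ Σsplit w G
  Σsplit-cong []      e = +-cong (e [] []) refl
  Σsplit-cong (x ∷ w) e = +-cong (e [] (x ∷ w)) (Σsplit-cong w (λ a b → e (x ∷ a) b))

  Σsplit-+ : ∀ w (F G : Word → Word → Carrier) → Σsplit w (λ a b → F a b + G a b) ≈ Σsplit w F + Σsplit w G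
  Σsplit-+ []      F G = trans (+-identityʳ _) (+-cong (sym (+-identityʳ _)) (sym (+-identityʳ _)))
  Σsplit-+ (x ∷ w) F G = trans (+-congˡ (Σsplit-+ w _ _)) (+-interchange _ _ _ _)

  Σsplit-zero : ∀ w {F : Word → Word → Carrier} → (∀ a b → F a b ≈ 0#) → Σsplit w F ≈ 0#
  Σsplit-zero []      e = trans (+-identityʳ _) (e [] [])
  Σsplit-zero (x ∷ w) e = trans (+-cong (e [] (x ∷ w)) (Σsplit-zero w (λ a b → e (x ∷ a) b))) (+-identityʳ _)

  Σsplit-*ʳ : ∀ w (F : Word → Word → Carrier) k → Σsplit w (λ a b → F a b * k) ≈ Σsplit w F * k
  Σsplit-*ʳ []      F k = trans (+-congˡ (sym (zeroˡ k))) (sym (distribʳ k _ _))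
  Σsplit-*ʳ (x ∷ w) F k = trans (+-congˡ (Σsplit-*ʳ w _ k)) (sym (distribʳ k _ _))

  Σsplit-*ˡ : ∀ w (F : Word → Word → Carrier) k → Σsplit w (λ a b → k * F a b) ≈ k * Σsplit w F
  Σsplit-*ˡ w F k = trans (Σsplit-cong w (λ a b → *-comm k _)) (trans (Σsplit-*ʳ w F k) (*-comm _ k))

  ⋆-Σsplit : ∀ (u v : Ser²) w w' →
    (u ⋆ v) w w' ≈ Σsplit w (λ a b → Σsplit w' (λ a' b' → u a a' * v b b'))
  ⋆-Σsplit u v w w' =
    trans (reflexive (Σsplit-≡ w _)) (Σsplit-cong w (λ a b → reflexive (Σsplit-≡ w' _)))

  ⋆-distribˡ : ∀ (u v v' : Ser²) w w' → (u ⋆ (v +ˢ v')) w w' ≈ (u ⋆ v) w w' + (u ⋆ v') w w'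
  ⋆-distribˡ u v v' w w' = begin
    (u ⋆ (v +ˢ v')) w w'
      ≈⟨ ⋆-Σsplit u (v +ˢ v') w w' ⟩
    Σsplit w (λ a b → Σsplit w' (λ a' b' → u a a' * (v b b' + v' b b')))
      ≈⟨ Σsplit-cong w (λ a b → trans (Σsplit-cong w' (λ a' b' → distribˡ _ _ _)) (Σsplit-+ w' _ _)) ⟩
    Σsplit w (λ a b → Σsplit w' (λ a' b' → u a a' * v b b') + Σsplit w' (λ a' b' → u a a' * v' b b'))
      ≈⟨ Σsplit-+ w _ _ ⟩
    Σsplit w (λ a b → Σsplit w' (λ a' b' → u a a' * v b b'))
      + Σsplit w (λ a b → Σsplit w' (λ a' b' → u a a' * v' b b'))
      ≈⟨ sym (+-cong (⋆-Σsplit u v w w') (⋆-Σsplit u v' w w')) ⟩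
    (u ⋆ v) w w' + (u ⋆ v') w w' ∎

  ⋆-distribʳ : ∀ (u v v' : Ser²) w w' → ((v +ˢ v') ⋆ u) w w' ≈ (v ⋆ u) w w' + (v' ⋆ u) w w'
  ⋆-distribʳ u v v' w w' = begin
    ((v +ˢ v') ⋆ u) w w'
      ≈⟨ ⋆-Σsplit (v +ˢ v') u w w' ⟩
    Σsplit w (λ a b → Σsplit w' (λ a' b' → (v a a' + v' a a') * u b b'))
      ≈⟨ Σsplit-cong w (λ a b → trans (Σsplit-cong w' (λ a' b' → distribʳ _ _ _)) (Σsplit-+ w' _ _)) ⟩
    Σsplit w (λ a b → Σsplit w' (λ a' b' → v a a' * u b b') + Σsplit w' (λ a' b' → v' a a' * u b b'))
      ≈⟨ Σsplit-+ w _ _ ⟩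
    Σsplit w (λ a b → Σsplit w' (λ a' b' → v a a' * u b b'))
      + Σsplit w (λ a b → Σsplit w' (λ a' b' → v' a a' * u b b'))
      ≈⟨ sym (+-cong (⋆-Σsplit v u w w') (⋆-Σsplit v' u w w')) ⟩
    (v ⋆ u) w w' + (v' ⋆ u) w w' ∎

  ⋆-monoʳ : ∀ (u : Ser²) v v' w w' →
    (u ⋆ mono v v') w w' ≈ Σsplit w (λ a b → Σsplit w' (λ a' b' → u a a' * δ v' b') * δ v b)
  ⋆-monoʳ u v v' w w' = trans (⋆-Σsplit u (mono v v') w w') (Σsplit-cong w (λ a b →
    trans (Σsplit-cong w' (λ a' b' → trans (*-congˡ (*-comm _ _)) (sym (*-assoc _ _ _))))
          (Σsplit-*ʳ w' _ _)))

  ⋆-monoˡ : ∀ (u : Ser²) v v' w w' →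
    (mono v v' ⋆ u) w w' ≈ Σsplit w (λ a b → δ v a * Σsplit w' (λ a' b' → δ v' a' * u b b'))
  ⋆-monoˡ u v v' w w' = trans (⋆-Σsplit (mono v v') u w w') (Σsplit-cong w (λ a b →
    trans (Σsplit-cong w' (λ a' b' → *-assoc _ _ _)) (Σsplit-*ˡ w' _ _)))

  -- Products of a one-variable series with e₁:
  -- (f ·e₁)[w] = f[a] if w = a e₁, and (e₁· f)[w] = f[a] if w = e₁ a; 0 otherwise.
  _·e₁ : (Word → Carrier) → Word → Carrier
  (f ·e₁) []          = 0#
  (f ·e₁) (x ∷ y ∷ w) = ((λ a → f (x ∷ a)) ·e₁) (y ∷ w)
  (f ·e₁) (e₀ ∷ [])   = 0#
  (f ·e₁) (e₁ ∷ [])   = f []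

  e₁·_ : (Word → Carrier) → Word → Carrier
  (e₁· f) (e₁ ∷ w) = f w
  (e₁· f) _        = 0#

  ·e₁-∷ʳ : ∀ w (f : Word → Carrier) → (f ·e₁) (w ∷ʳ e₁) ≡ f w
  ·e₁-∷ʳ []           f = P.refl
  ·e₁-∷ʳ (e₀ ∷ [])    f = P.refl
  ·e₁-∷ʳ (e₁ ∷ [])    f = P.refl
  ·e₁-∷ʳ (x ∷ y ∷ w)  f = ·e₁-∷ʳ (y ∷ w) (λ a → f (x ∷ a))

  ·e₁-power : ∀ n (f : Word → Carrier) → (f ·e₁) (replicate n e₁) ≡ (e₁· f) (replicate n e₁)
  ·e₁-power zero          f = P.refl
  ·e₁-power (suc zero)    f = P.refl
  ·e₁-power (suc (suc n)) f = ·e₁-power (suc n) (λ a → f (e₁ ∷ a))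

  ·e₁-zero : ∀ w (f : Word → Carrier) → (∀ a → a ∷ʳ e₁ ≡ w → f a ≈ 0#) → (f ·e₁) w ≈ 0#
  ·e₁-zero []          f h = refl
  ·e₁-zero (e₀ ∷ [])   f h = refl
  ·e₁-zero (e₁ ∷ [])   f h = h [] P.refl
  ·e₁-zero (x ∷ y ∷ w) f h = ·e₁-zero (y ∷ w) (λ a → f (x ∷ a)) (λ a eq → h (x ∷ a) (P.cong (x ∷_) eq))

  e₁·-zero : ∀ w (f : Word → Carrier) → (∀ a → e₁ ∷ a ≡ w → f a ≈ 0#) → (e₁· f) w ≈ 0#
  e₁·-zero []       f h = refl
  e₁·-zero (e₀ ∷ w) f h = refl
  e₁·-zero (e₁ ∷ w) f h = h w P.refl

  Σsplit-1ʳ : ∀ w (F : Word → Carrier) → Σsplit w (λ a b → F a * δ [] b) ≈ F w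
  Σsplit-1ʳ []      F = trans (+-identityʳ _) (*-identityʳ _)
  Σsplit-1ʳ (x ∷ w) F = trans (+-cong (zeroʳ _) (Σsplit-1ʳ w (λ a → F (x ∷ a)))) (+-identityˡ _)

  Σsplit-e₁ʳ : ∀ w (F : Word → Carrier) → Σsplit w (λ a b → F a * δ (e₁ ∷ []) b) ≈ (F ·e₁) w
  Σsplit-e₁ʳ []           F = trans (+-identityʳ _) (zeroʳ _)
  Σsplit-e₁ʳ (e₀ ∷ [])    F = trans (+-cong (zeroʳ _) (trans (+-identityʳ _) (zeroʳ _))) (+-identityʳ _)
  Σsplit-e₁ʳ (e₁ ∷ [])    F = trans (+-cong (*-identityʳ _) (trans (+-identityʳ _) (zeroʳ _))) (+-identityʳ _)
  Σsplit-e₁ʳ (e₀ ∷ y ∷ w) F = trans (+-cong (zeroʳ _) (Σsplit-e₁ʳ (y ∷ w) _)) (+-identityˡ _)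
  Σsplit-e₁ʳ (e₁ ∷ y ∷ w) F = trans (+-cong (zeroʳ _) (Σsplit-e₁ʳ (y ∷ w) _)) (+-identityˡ _)

  Σsplit-1ˡ : ∀ w (G : Word → Carrier) → Σsplit w (λ a b → δ [] a * G b) ≈ G w
  Σsplit-1ˡ []      G = trans (+-identityʳ _) (*-identityˡ _)
  Σsplit-1ˡ (x ∷ w) G = trans (+-cong (*-identityˡ _) (Σsplit-zero w (λ a b → zeroˡ _))) (+-identityʳ _)

  Σsplit-e₁ˡ : ∀ w (G : Word → Carrier) → Σsplit w (λ a b → δ (e₁ ∷ []) a * G b) ≈ (e₁· G) w
  Σsplit-e₁ˡ []       G = trans (+-identityʳ _) (zeroˡ _)
  Σsplit-e₁ˡ (e₀ ∷ w) G = trans (+-cong (zeroˡ _) (Σsplit-zero w (λ a b → zeroˡ _))) (+-identityʳ _)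
  Σsplit-e₁ˡ (e₁ ∷ w) G = trans (+-cong (zeroˡ _) (Σsplit-1ˡ w G)) (+-identityˡ _)

  ⋆-Δe₁ : ∀ (u : Ser²) w w' → (u ⋆ Δe₁) w w' ≈ ((λ a → u a w') ·e₁) w + (u w ·e₁) w'
  ⋆-Δe₁ u w w' = begin
    (u ⋆ Δe₁) w w'
      ≈⟨ ⋆-distribˡ u _ _ w w' ⟩
    (u ⋆ mono (e₁ ∷ []) []) w w' + (u ⋆ mono [] (e₁ ∷ [])) w w'
      ≈⟨ +-cong (⋆-monoʳ u (e₁ ∷ []) [] w w') (⋆-monoʳ u [] (e₁ ∷ []) w w') ⟩
    Σsplit w (λ a b → Σsplit w' (λ a' b' → u a a' * δ [] b') * δ (e₁ ∷ []) b)
      + Σsplit w (λ a b → Σsplit w' (λ a' b' → u a a' * δ (e₁ ∷ []) b') * δ [] b)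
      ≈⟨ +-cong (Σsplit-cong w (λ a b → *-congʳ (Σsplit-1ʳ w' (u a))))
                (Σsplit-cong w (λ a b → *-congʳ (Σsplit-e₁ʳ w' (u a)))) ⟩
    Σsplit w (λ a b → u a w' * δ (e₁ ∷ []) b) + Σsplit w (λ a b → (u a ·e₁) w' * δ [] b)
      ≈⟨ +-cong (Σsplit-e₁ʳ w _) (Σsplit-1ʳ w _) ⟩
    ((λ a → u a w') ·e₁) w + (u w ·e₁) w' ∎

  Δe₁-⋆ : ∀ (u : Ser²) w w' → (Δe₁ ⋆ u) w w' ≈ (e₁· (λ a → u a w')) w + (e₁· u w) w'
  Δe₁-⋆ u w w' = begin
    (Δe₁ ⋆ u) w w'
      ≈⟨ ⋆-distribʳ u _ _ w w' ⟩
    (mono (e₁ ∷ []) [] ⋆ u) w w' + (mono [] (e₁ ∷ []) ⋆ u) w w'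
      ≈⟨ +-cong (⋆-monoˡ u (e₁ ∷ []) [] w w') (⋆-monoˡ u [] (e₁ ∷ []) w w') ⟩
    Σsplit w (λ a b → δ (e₁ ∷ []) a * Σsplit w' (λ a' b' → δ [] a' * u b b'))
      + Σsplit w (λ a b → δ [] a * Σsplit w' (λ a' b' → δ (e₁ ∷ []) a' * u b b'))
      ≈⟨ +-cong (Σsplit-cong w (λ a b → *-congˡ (Σsplit-1ˡ w' (u b))))
                (Σsplit-cong w (λ a b → *-congˡ (Σsplit-e₁ˡ w' (u b)))) ⟩
    Σsplit w (λ a b → δ (e₁ ∷ []) a * u b w') + Σsplit w (λ a b → δ [] a * (e₁· u b) w')
      ≈⟨ +-cong (Σsplit-e₁ˡ w _) (Σsplit-1ˡ w _) ⟩
    (e₁· (λ a → u a w')) w + (e₁· u w) w' ∎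

  -- The coefficient of w ⊗ w' in the commutation relation u ⋆ Δe₁ = Δe₁ ⋆ u.
  CommEq : Ser² → Word → Word → Set ℓ
  CommEq u w w' = ((λ a → u a w') ·e₁) w + (u w ·e₁) w' ≈ (e₁· (λ a → u a w')) w + (e₁· u w) w'

  commEq-of-commutes : ∀ (u : Ser²) → (u ⋆ Δe₁) ≈ˢ (Δe₁ ⋆ u) → ∀ w w' → CommEq u w w'
  commEq-of-commutes u comm w w' = trans (sym (⋆-Δe₁ u w w')) (trans (comm w w') (Δe₁-⋆ u w w'))

  commutes-of-commEq : ∀ (u : Ser²) → (∀ w w' → CommEq u w w') → (u ⋆ Δe₁) ≈ˢ (Δe₁ ⋆ u)
  commutes-of-commEq u eqs w w' = trans (⋆-Δe₁ u w w') (trans (eqs w w') (sym (Δe₁-⋆ u w w')))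

  -- The flip τ of the two tensor factors preserves the relation, since τ(Δe₁) = Δe₁.
  transpose : Ser² → Ser²
  transpose u w w' = u w' w

  commEq-transpose : ∀ (u : Ser²) w w' → CommEq (transpose u) w' w → CommEq u w w'
  commEq-transpose u w w' eq = trans (+-comm _ _) (trans eq (+-comm _ _))

  Supported : Ser² → Set ℓ
  Supported u = ∀ w w' → (¬ IsE1Power w ⊎ ¬ IsE1Power w') → u w w' ≈ 0#

  commEq-at-nonpower : ∀ (u : Ser²) → (∀ v x → ¬ IsE1Power v → u v x ≈ 0#) →
    ∀ w w' → ¬ IsE1Power w → CommEq u w w'
  commEq-at-nonpower u vanish w w' np = begin
    ((λ a → u a w') ·e₁) w + (u w ·e₁) w'
      ≈⟨ +-cong (·e₁-zero w _ (λ a eq → vanish a w' (λ p → np (P.subst IsE1Power eq (power-∷ʳe₁ p)))))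
                (·e₁-zero w' _ (λ a _ → vanish w a np)) ⟩
    0# + 0#
      ≈⟨ sym (+-cong (e₁·-zero w _ (λ a eq → vanish a w' (λ p → np (P.subst IsE1Power eq (power-e₁∷ p)))))
                     (e₁·-zero w' _ (λ a _ → vanish w a np))) ⟩
    (e₁· (λ a → u a w')) w + (e₁· u w) w' ∎

  commEq-of-supported : ∀ (u : Ser²) → Supported u → ∀ w w' → CommEq u w w'
  commEq-of-supported u sup w w' with e1View w | e1View w'
  ... | is-mixed k t | _ =
    commEq-at-nonpower u (λ v x np → sup v x (inj₁ np)) _ w' (mixed-not-power k t)
  ... | is-power n | is-mixed k t =
    commEq-transpose u _ (mixed k t)
      (commEq-at-nonpower (transpose u) (λ v x np → sup x v (inj₂ np)) (mixed k t) _ (mixed-not-power k t))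
  ... | is-power n | is-power m = +-cong (reflexive (·e₁-power n _)) (reflexive (·e₁-power m _))

  cancel-zeros : ∀ {a b c d} → a + b ≈ c + d → b ≈ 0# → c ≈ 0# → d ≈ 0# → a ≈ 0#
  cancel-zeros {a} {b} {c} {d} eq b≈0 c≈0 d≈0 = begin
    a       ≈⟨ sym (+-identityʳ a) ⟩
    a + 0#  ≈⟨ +-congˡ (sym b≈0) ⟩
    a + b   ≈⟨ eq ⟩
    c + d   ≈⟨ +-cong c≈0 d≈0 ⟩
    0# + 0# ≈⟨ +-identityʳ 0# ⟩
    0#      ∎

  -- (⇒) Induction on k + |w'| (bounded by the fuel n): the relation at
  -- (e₁ᵏ e₀ t e₁) ⊗ w' writes u[e₁ᵏ e₀ t ⊗ w'] as a sum of coefficients at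
  -- (e₁ᵏ e₀ t e₁) ⊗ (shorter word) and (e₁ᵏ⁻¹ e₀ t e₁) ⊗ w'.
  vanish-mixed : ∀ (u : Ser²) → (∀ w w' → CommEq u w w') →
    ∀ n k t w' → k +ℕ length w' < n → u (mixed k t) w' ≈ 0#
  vanish-mixed u eqs (suc n) k t w' (s≤s bound) =
    cancel-zeros (P.subst (λ z → z + (u V ·e₁) w' ≈ (e₁· (λ a → u a w')) V + (e₁· u V) w')
                          removeLast (eqs V w'))
                 (·e₁-zero w' (u V) (λ a eq → row a (init-shorter e₁ eq)))
                 (dropHead k bound)
                 (e₁·-zero w' (u V) (λ a eq → row a (tail-shorter e₁ eq)))
    where
      V : Word
      V = mixed k (t ∷ʳ e₁)

      removeLast : ((λ a → u a w') ·e₁) V ≡ u (mixed k t) w'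
      removeLast = P.trans (P.cong ((λ a → u a w') ·e₁) (P.sym (mixed-∷ʳ k t))) (·e₁-∷ʳ (mixed k t) _)

      row : ∀ a → length a < length w' → u V a ≈ 0#
      row a shorter = vanish-mixed u eqs n k (t ∷ʳ e₁) a (<-≤-trans (+-monoʳ-< k shorter) bound)

      -- e₁ \ (e₁ʲ e₀ t e₁) is 0 for j = 0 and e₁ʲ⁻¹ e₀ t e₁ otherwise.
      dropHead : ∀ j → j +ℕ length w' ≤ n → (e₁· (λ a → u a w')) (mixed j (t ∷ʳ e₁)) ≈ 0#
      dropHead zero    _       = refl
      dropHead (suc j) j-bound = vanish-mixed u eqs n j (t ∷ʳ e₁) w' j-bound

  vanish-nonpower : ∀ (u : Ser²) → (∀ w w' → CommEq u w w') → ∀ w w' → ¬ IsE1Power w → u w w' ≈ 0#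
  vanish-nonpower u eqs w w' np with e1View w
  ... | is-power n   = ⊥-elim (np (n , P.refl))
  ... | is-mixed k t = vanish-mixed u eqs _ k t w' (n<1+n _)

  supported-of-commEq : ∀ (u : Ser²) → (∀ w w' → CommEq u w w') → Supported u
  supported-of-commEq u eqs w w' (inj₁ np) = vanish-nonpower u eqs w w' np
  supported-of-commEq u eqs w w' (inj₂ np) =
    vanish-nonpower (transpose u) (λ v v' → commEq-transpose (transpose u) v v' (eqs v' v)) w' w np

open Commutation using (commEq-of-commutes; commutes-of-commEq; supported-of-commEq; commEq-of-supported)

lemma3p4 : {c ℓ : Level} (R : CommutativeRing c ℓ) →
    let open CommutativeRing R
        open Series R
    in IsℚAlgebra → (u : Ser²) →
       ((u ⋆ Δe₁) ≈ˢ (Δe₁ ⋆ u))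
       ⇔ (∀ w w' → (¬ IsE1Power w ⊎ ¬ IsE1Power w') → u w w' ≈ 0#)
lemma3p4 R _ u = mk⇔
  (λ commutes → supported-of-commEq R u (commEq-of-commutes R u commutes))
  (λ supported → commutes-of-commEq R u (commEq-of-supported R u supported))
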